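{- Let $p$ be a prime with $p\equiv 2\pmod 3$. Then $H(p)=N_{\rm ns}(p)\cap N_{\rm sp}(p)$ is a subgroup of \[G(p)=\{a^3:a\in C_{\rm ns}(p)\}\cup\left\{\begin{pmatrix}1&0\\0&-1\end{pmatrix}a^3:a\in C_{\rm ns}(p)\right\}.\]
   Context: Fix a generator $\epsilon_p$ of $\mathbb{F}_p^\times$. $C_{\rm ns}(p)=\left\{\begin{pmatrix}a&\epsilon_p b\\ b&a\end{pmatrix}:(a,b)\in\mathbb{F}_p^2\setminus\{(0,0)\}\right\}$, $N_{\rm ns}(p)=C_{\rm ns}(p)\cup\mathrm{diag}(1,-1)C_{\rm ns}(p)$, and $N_{\rm sp}(p)$ is the subgroup of diagonal and anti-diagonal matrices in $\mathrm{GL}_2(\mathbb{F}_p)$. -}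

module Defs where

open import Data.Nat as ℕ using (ℕ)
open import Data.Integer using (ℤ; +_; _+_; _*_; -_; _-_; _^_)
open import Data.Integer.Divisibility using (_∣_)
open import Data.Product using (Σ; ∃; ∃-syntax; _×_; _,_)
open import Data.Sum using (_⊎_)
open import Relation.Nullary using (¬_)

-- Elements of 𝔽_p are represented by integers; equality in 𝔽_p is
-- congruence modulo p.
infix 4 _≡[_]_ _≈[_]_
infixl 7 _·_

_≡[_]_ : ℤ → ℕ → ℤ → Set
a ≡[ p ] b = (+ p) ∣ (a - b)

record Mat : Set where
  constructor mat
  field
    m00 m01 m10 m11 : ℤ
open Mat public

_·_ : Mat → Mat → Mat
mat a b c d · mat e f g h = mat (a * e + b * g) (a * f + b * h) (c * e + d * g) (c * f + d * h)

_≈[_]_ : Mat → ℕ → Mat → Set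
M ≈[ p ] N = (m00 M ≡[ p ] m00 N) × (m01 M ≡[ p ] m01 N)
           × (m10 M ≡[ p ] m10 N) × (m11 M ≡[ p ] m11 N)

det : Mat → ℤ
det (mat a b c d) = a * d - b * c

Invertible : ℕ → Mat → Set
Invertible p M = ¬ (det M ≡[ p ] + 0)

IsGenerator : ℕ → ℤ → Set
IsGenerator p ε = ¬ (ε ≡[ p ] + 0) ×
  ((x : ℤ) → ¬ (x ≡[ p ] + 0) → ∃[ k ] ((ε ^ k) ≡[ p ] x))

diag1-1 : Mat
diag1-1 = mat (+ 1) (+ 0) (+ 0) (- (+ 1))

cube : Mat → Mat
cube A = A · (A · A)

InCns : ℕ → ℤ → Mat → Set
InCns p ε M = ∃[ a ] ∃[ b ] (¬ ((a ≡[ p ] + 0) × (b ≡[ p ] + 0)) × (M ≈[ p ] mat a (ε * b) b a))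

InNns : ℕ → ℤ → Mat → Set
InNns p ε M = InCns p ε M ⊎ ∃[ C ] (InCns p ε C × (M ≈[ p ] (diag1-1 · C)))

InNsp : ℕ → Mat → Set
InNsp p M = Invertible p M ×
  (((m01 M ≡[ p ] + 0) × (m10 M ≡[ p ] + 0)) ⊎ ((m00 M ≡[ p ] + 0) × (m11 M ≡[ p ] + 0)))

InH : ℕ → ℤ → Mat → Set
InH p ε M = InNns p ε M × InNsp p M

InG : ℕ → ℤ → Mat → Set
InG p ε M = ∃[ A ] (InCns p ε A × ((M ≈[ p ] cube A) ⊎ (M ≈[ p ] (diag1-1 · cube A))))

module Submission where

-- An element of H(p) is an element [[a, εb], [b, a]] of C_ns(p), possibly
-- multiplied by diag(1, -1), which is diagonal (b = 0) or antidiagonal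
-- (a = 0). Since p ≡ 2 (mod 3), every x ∈ 𝔽_p is a cube: writing p = 3q + 2,
-- Fermat's little theorem gives (x^(2q+1))³ = x^(1 + 2(p-1)) = x. Hence aI is
-- the cube of cI with c³ = a, and [[0, εb], [b, 0]] is the cube of
-- [[0, εd], [d, 0]] with εd³ = b, i.e. d³ = ε^(p-2) b. Fermat's theorem itself
-- comes from the binomial theorem, since p divides every inner coefficient
-- of (x + y)^p.

open import Defs
open import Data.Nat using (ℕ)
open import Data.Nat.DivMod using (_%_)
open import Data.Nat.Primality using (Prime)
open import Data.Integer using (ℤ)
open import Relation.Binary.PropositionalEquality using (_≡_)

import Algebra.Properties.CommutativeSemiring.Binomial as Binomial
import Algebra.Properties.Semiring.Exp as Exp
import Algebra.Properties.Semiring.Mult as Mult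
import Algebra.Properties.Semiring.Sum as Sum
open import Data.Empty using (⊥-elim)
open import Data.Fin.Base using (Fin; zero; suc; inject₁; fromℕ)
open import Data.Fin.Properties using (toℕ<n; toℕ-inject₁; toℕ-fromℕ)
open import Data.Integer.Base using (+_; _+_; _*_; -_; _-_; _^_; ∣_∣)
open import Data.Integer.DivMod using (_%ℕ_; _/ℕ_; a≡a%ℕn+[a/ℕn]*n)
import Data.Integer.Divisibility.Signed as Signed
import Data.Integer.Properties as ℤₚ
open import Data.Integer.Tactic.RingSolver using (solve-∀; solve)
open import Data.List.Base using (_∷_; [])
open import Data.Nat as ℕ using (zero; suc; _<_; _∸_; _!)
open import Data.Nat.Combinatorics using (_C_; nCk≡n!/k![n-k]!; k![n∸k]!∣n!; nCn≡1)
open import Data.Nat.DivMod using (_/_; m/n*n≡m; m≡m%n+[m/n]*n)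
open import Data.Nat.Divisibility using (_∣_; _∣0; ∣1⇒≡1; ∣⇒≤; m∣m*n; ∣m⇒∣m*n)
open import Data.Nat.Primality using (euclidsLemma; prime⇒nonZero; prime⇒nonTrivial; ¬prime[0]; ¬prime[1])
import Data.Nat.Properties as ℕₚ
import Data.Nat.Tactic.RingSolver as ℕSolver
open import Data.Product using (∃-syntax; _×_; _,_; proj₁; proj₂)
open import Data.Sum using (_⊎_; inj₁; inj₂)
open import Function.Base using (_∘_)
open import Level using (0ℓ)
open import Relation.Binary.Bundles using (Setoid)
open import Relation.Nullary using (¬_)
open import Relation.Binary.PropositionalEquality
  using (refl; sym; trans; cong; cong₂; subst; module ≡-Reasoning)
import Relation.Binary.Reasoning.Setoid as SetoidReasoning

-- Congruence modulo p, wrapped in a record so that its two sides are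
-- inferable by unification (the underlying divisibility unfolds).
infix 4 _≅[_]_
record _≅[_]_ (a : ℤ) (p : ℕ) (b : ℤ) : Set where
  constructor wrap
  field unwrap : a ≡[ p ] b
open _≅[_]_ public

module _ {p : ℕ} where

  private
    divides : ∀ {a b} → + p Signed.∣ a - b → a ≅[ p ] b
    divides = wrap ∘ Signed.∣⇒∣ᵤ

    divisor : ∀ {a b} → a ≅[ p ] b → + p Signed.∣ a - b
    divisor = Signed.∣ᵤ⇒∣ ∘ unwrap

  ≅-reflexive : ∀ {a b} → a ≡ b → a ≅[ p ] b
  ≅-reflexive {a} refl = wrap (subst (λ d → p ∣ ∣ d ∣) (sym (ℤₚ.+-inverseʳ a)) (p ∣0))

  ≅-refl : ∀ {a} → a ≅[ p ] a
  ≅-refl = ≅-reflexive refl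

  ≅-sym : ∀ {a b} → a ≅[ p ] b → b ≅[ p ] a
  ≅-sym {a} {b} (wrap a≡b) = wrap (subst (p ∣_) (ℤₚ.∣i-j∣≡∣j-i∣ a b) a≡b)

  ≅-trans : ∀ {a b c} → a ≅[ p ] b → b ≅[ p ] c → a ≅[ p ] c
  ≅-trans {a} {b} {c} a≡b b≡c = divides (subst (+ p Signed.∣_) (ℤₚ.+-minus-telescope a b c)
    (Signed.∣m∣n⇒∣m+n (divisor a≡b) (divisor b≡c)))

  +-cong : ∀ {a b c d} → a ≅[ p ] b → c ≅[ p ] d → a + c ≅[ p ] b + d
  +-cong {a} {b} {c} {d} a≡b c≡d = divides (subst (+ p Signed.∣_) (sym (difference a b c d))
    (Signed.∣m∣n⇒∣m+n (divisor a≡b) (divisor c≡d)))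
    where
    difference : ∀ a b c d → (a + c) - (b + d) ≡ (a - b) + (c - d)
    difference = solve-∀

  *-cong : ∀ {a b c d} → a ≅[ p ] b → c ≅[ p ] d → a * c ≅[ p ] b * d
  *-cong {a} {b} {c} {d} a≡b c≡d = divides (subst (+ p Signed.∣_) (sym (difference a b c d))
    (Signed.∣m∣n⇒∣m+n (Signed.∣m⇒∣m*n c (divisor a≡b)) (Signed.∣n⇒∣m*n b (divisor c≡d))))
    where
    difference : ∀ a b c d → a * c - b * d ≡ (a - b) * c + b * (c - d)
    difference = solve-∀

  -‿cong : ∀ {a b} → a ≅[ p ] b → - a ≅[ p ] - b
  -‿cong {a} {b} a≡b = divides (subst (+ p Signed.∣_) (difference a b) (Signed.∣m⇒∣-m (divisor a≡b)))
    where
    difference : ∀ a b → - (a - b) ≡ - a - - b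
    difference = solve-∀

  ^-cong : ∀ {a b} n → a ≅[ p ] b → a ^ n ≅[ p ] b ^ n
  ^-cong zero    a≡b = ≅-refl
  ^-cong (suc n) a≡b = *-cong a≡b (^-cong n a≡b)

  ≅-%ℕ : ∀ a .{{_ : ℕ.NonZero p}} → a ≅[ p ] + (a %ℕ p)
  ≅-%ℕ a = divides (Signed.divides (a /ℕ p) (cancel (a≡a%ℕn+[a/ℕn]*n a p)))
    where
    cancel : ∀ {a r s} → a ≡ r + s → a - r ≡ s
    cancel {r = r} {s} refl = solve (r ∷ s ∷ [])

  ∣⇒≅0 : ∀ {a} → p ∣ ∣ a ∣ → a ≅[ p ] + 0
  ∣⇒≅0 {a} = wrap ∘ subst (λ d → p ∣ ∣ d ∣) (sym (ℤₚ.+-identityʳ a))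

≅-setoid : ℕ → Setoid 0ℓ 0ℓ
≅-setoid p = record
  { Carrier       = ℤ
  ; _≈_           = _≅[ p ]_
  ; isEquivalence = record { refl = ≅-refl ; sym = ≅-sym ; trans = ≅-trans }
  }

n∣n! : ∀ n .{{_ : ℕ.NonZero n}} → n ∣ n !
n∣n! (suc n) = m∣m*n (n !)

nCk*k![n∸k]!≡n! : ∀ {n k} → k ℕ.≤ n → (n C k) ℕ.* (k ! ℕ.* (n ∸ k) !) ≡ n !
nCk*k![n∸k]!≡n! {n} {k} k≤n = trans (cong (ℕ._* (k ! ℕ.* (n ∸ k) !)) (nCk≡n!/k![n-k]! k≤n))
  (m/n*n≡m {{ℕₚ._!*_!≢0 k (n ∸ k)}} (k![n∸k]!∣n! k≤n))

module _ {p : ℕ} (p-prime : Prime p) where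

  private instance
    p≢0 : ℕ.NonZero p
    p≢0 = prime⇒nonZero p-prime

  p∤m! : ∀ {m} → m < p → ¬ p ∣ m !
  p∤m! {zero}  _   p∣1 = ¬prime[1] (subst Prime (∣1⇒≡1 p∣1) p-prime)
  p∤m! {suc m} m<p p∣m! with euclidsLemma (suc m) (m !) p-prime p∣m!
  ... | inj₁ p∣1+m = ℕₚ.<⇒≱ m<p (∣⇒≤ p∣1+m)
  ... | inj₂ p∣m!  = p∤m! (ℕₚ.<-trans (ℕₚ.n<1+n m) m<p) p∣m!

  p∣pCk : ∀ {k} → 0 < k → k < p → p ∣ p C k
  p∣pCk {k} 0<k k<p
    with euclidsLemma (p C k) _ p-prime (subst (p ∣_) (sym (nCk*k![n∸k]!≡n! (ℕₚ.<⇒≤ k<p))) (n∣n! p))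
  ... | inj₁ p∣pCk = p∣pCk
  ... | inj₂ p∣k![p∸k]! with euclidsLemma (k !) ((p ∸ k) !) p-prime p∣k![p∸k]!
  ...   | inj₁ p∣k!     = ⊥-elim (p∤m! k<p p∣k!)
  ...   | inj₂ p∣[p∸k]! = ⊥-elim (p∤m! (ℕₚ.∸-monoʳ-< 0<k (ℕₚ.<⇒≤ k<p)) p∣[p∸k]!)

private
  module ℤ-binomial = Binomial ℤₚ.+-*-commutativeSemiring
  module ℤ-exp = Exp ℤₚ.+-*-semiring
  module ℤ-mult = Mult ℤₚ.+-*-semiring
  module ℤ-sum = Sum ℤₚ.+-*-semiring

semiring-^≡^ : ∀ x n → x ℤ-exp.^ n ≡ x ^ n
semiring-^≡^ x zero    = refl
semiring-^≡^ x (suc n) = cong (x *_) (semiring-^≡^ x n)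

semiring-×≡* : ∀ n x → n ℤ-mult.× x ≡ + n * x
semiring-×≡* zero    x = refl
semiring-×≡* (suc n) x = trans (cong (_+_ x) (semiring-×≡* n x)) (sym (ℤₚ.suc-* (+ n) x))

binomialTerm-first : ∀ x y n → ℤ-binomial.binomialTerm x y n zero ≡ y ^ n
binomialTerm-first x y n = trans (ℤₚ.+-identityʳ _) (trans (ℤₚ.*-identityˡ _) (semiring-^≡^ y n))

binomialTerm-last : ∀ x y n → ℤ-binomial.binomialTerm x y n (fromℕ n) ≡ x ^ n
binomialTerm-last x y n rewrite toℕ-fromℕ n | nCn≡1 n | ℕₚ.n∸n≡0 n =
  trans (ℤₚ.+-identityʳ _) (trans (ℤₚ.*-identityʳ _) (semiring-^≡^ x n))

module _ {p : ℕ} where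

  ×-≅0 : ∀ {n} x → p ∣ n → n ℤ-mult.× x ≅[ p ] + 0
  ×-≅0 {n} x p∣n = ∣⇒≅0 (subst (λ d → p ∣ ∣ d ∣) (sym (semiring-×≡* n x))
    (subst (p ∣_) (sym (ℤₚ.abs-* (+ n) x)) (∣m⇒∣m*n ∣ x ∣ p∣n)))

  sum-≅0 : ∀ {n} (f : Fin n → ℤ) → (∀ i → f i ≅[ p ] + 0) → ℤ-sum.sum f ≅[ p ] + 0
  sum-≅0 {zero}  f f≅0 = ≅-refl
  sum-≅0 {suc n} f f≅0 = +-cong (f≅0 zero) (sum-≅0 (f ∘ suc) (f≅0 ∘ suc))

  freshman's-dream : ∀ m → (∀ {k} → 0 < k → k < suc m → p ∣ suc m C k) →
                     ∀ x y → (x + y) ^ suc m ≅[ p ] x ^ suc m + y ^ suc m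
  freshman's-dream m p∣coefficient x y = begin
    (x + y) ^ n
      ≡⟨ semiring-^≡^ (x + y) n ⟨
    (x + y) ℤ-exp.^ n
      ≡⟨ ℤ-binomial.theorem n x y ⟩
    term zero + ℤ-sum.sum (term ∘ suc)
      ≡⟨ cong (_+_ (term zero)) (ℤ-sum.sum-init-last (term ∘ suc)) ⟩
    term zero + (ℤ-sum.sum inner + term (fromℕ n))
      ≈⟨ +-cong (≅-refl {a = term zero}) (+-cong inner≅0 (≅-refl {a = term (fromℕ n)})) ⟩
    term zero + (+ 0 + term (fromℕ n))
      ≡⟨ cong₂ (λ a b → a + (+ 0 + b)) (binomialTerm-first x y n) (binomialTerm-last x y n) ⟩
    y ^ n + (+ 0 + x ^ n)
      ≡⟨ rearrange (y ^ n) (x ^ n) ⟩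
    x ^ n + y ^ n ∎
    where
    open SetoidReasoning (≅-setoid p)
    n = suc m
    term = ℤ-binomial.binomialTerm x y n
    inner = λ (i : Fin m) → term (suc (inject₁ i))
    inner≅0 : ℤ-sum.sum inner ≅[ p ] + 0
    inner≅0 = sum-≅0 inner λ i → ×-≅0 _ (p∣coefficient ℕ.z<s
      (ℕ.s<s (subst (_< m) (sym (toℕ-inject₁ i)) (toℕ<n i))))
    rearrange : ∀ a b → a + (+ 0 + b) ≡ b + a
    rearrange = solve-∀

fermat : ∀ {p} → Prime p → ∀ x → x ^ p ≅[ p ] x
fermat {zero}  p-prime = ⊥-elim (¬prime[0] p-prime)
fermat {suc m} p-prime x = begin
  x ^ p            ≈⟨ ^-cong p (≅-%ℕ x) ⟩
  (+ (x %ℕ p)) ^ p ≈⟨ fermat-ℕ (x %ℕ p) ⟩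
  + (x %ℕ p)       ≈⟨ ≅-sym (≅-%ℕ x) ⟩
  x                ∎
  where
  open SetoidReasoning (≅-setoid (suc m))
  p = suc m
  fermat-ℕ : ∀ n → (+ n) ^ p ≅[ p ] + n
  fermat-ℕ zero    = ≅-refl
  fermat-ℕ (suc n) = ≅-trans (freshman's-dream m (p∣pCk p-prime) (+ 1) (+ n))
    (+-cong (≅-reflexive (ℤₚ.^-zeroˡ p)) (fermat-ℕ n))

module _ {p : ℕ} (p-prime : Prime p) where

  private instance
    p≢0 : ℕ.NonZero p
    p≢0 = prime⇒nonZero p-prime

  *-cancelˡ-≅ : ∀ {a b c} → ¬ (a ≅[ p ] + 0) → a * b ≅[ p ] a * c → b ≅[ p ] c
  *-cancelˡ-≅ {a} {b} {c} a≢0 (wrap p∣ab-ac)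
    with euclidsLemma ∣ a ∣ ∣ b - c ∣ p-prime (subst (p ∣_) (abs-factor a b c) p∣ab-ac)
    where
    abs-factor : ∀ a b c → ∣ a * b - a * c ∣ ≡ ∣ a ∣ ℕ.* ∣ b - c ∣
    abs-factor a b c = trans (cong ∣_∣ (factor a b c)) (ℤₚ.abs-* a (b - c))
      where
      factor : ∀ a b c → a * b - a * c ≡ a * (b - c)
      factor = solve-∀
  ... | inj₁ p∣a   = ⊥-elim (a≢0 (∣⇒≅0 p∣a))
  ... | inj₂ p∣b-c = wrap p∣b-c

  fermat-iterated : ∀ k x → x ^ suc (k ℕ.* (p ∸ 1)) ≅[ p ] x
  fermat-iterated zero    x = ≅-reflexive (ℤₚ.*-identityʳ x)
  fermat-iterated (suc k) x = begin
    x ^ (suc (p ∸ 1) ℕ.+ m)  ≡⟨ ℤₚ.^-distribˡ-+-* x (suc (p ∸ 1)) m ⟩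
    x ^ suc (p ∸ 1) * x ^ m  ≡⟨ cong (λ n → x ^ n * x ^ m) (ℕₚ.suc-pred p) ⟩
    x ^ p * x ^ m            ≈⟨ *-cong (fermat p-prime x) (≅-refl {a = x ^ m}) ⟩
    x ^ suc m                ≈⟨ fermat-iterated k x ⟩
    x                        ∎
    where
    open SetoidReasoning (≅-setoid p)
    m = k ℕ.* (p ∸ 1)

  fermat-inverse : ∀ {x} → ¬ (x ≅[ p ] + 0) → x * x ^ (p ∸ 2) ≅[ p ] + 1
  fermat-inverse {x} x≢0 = *-cancelˡ-≅ x≢0 (begin
    x * (x * x ^ (p ∸ 2))  ≡⟨ cong (x ^_) (ℕₚ.m+[n∸m]≡n (ℕ.nonTrivial⇒n>1 p {{prime⇒nonTrivial p-prime}})) ⟩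
    x ^ p                  ≈⟨ fermat p-prime x ⟩
    x                      ≡⟨ ℤₚ.*-identityʳ x ⟨
    x * + 1                ∎)
    where open SetoidReasoning (≅-setoid p)

  cube-root : p % 3 ≡ 2 → ∀ x → ∃[ c ] (c * c * c ≅[ p ] x)
  cube-root p%3≡2 x = c , (begin
    c * c * c                      ≡⟨ cube≡^3 c ⟩
    c ^ 3                          ≡⟨ ℤₚ.^-*-assoc x (suc (2 ℕ.* q)) 3 ⟩
    x ^ (suc (2 ℕ.* q) ℕ.* 3)      ≡⟨ cong (x ^_) exponent ⟩
    x ^ suc (2 ℕ.* (p ∸ 1))        ≈⟨ fermat-iterated 2 x ⟩
    x                              ∎)
    where
    open SetoidReasoning (≅-setoid p)
    q = p / 3
    c = x ^ suc (2 ℕ.* q)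
    cube≡^3 : ∀ c → c * c * c ≡ c * (c * (c * + 1))
    cube≡^3 = solve-∀
    p∸1≡3q+1 : p ∸ 1 ≡ suc (q ℕ.* 3)
    p∸1≡3q+1 = cong (_∸ 1) (trans (m≡m%n+[m/n]*n p 3) (cong (ℕ._+ q ℕ.* 3) p%3≡2))
    exponent : suc (2 ℕ.* q) ℕ.* 3 ≡ suc (2 ℕ.* (p ∸ 1))
    exponent = trans (expand q) (cong (λ n → suc (2 ℕ.* n)) (sym p∸1≡3q+1))
      where
      expand : ∀ q → suc (2 ℕ.* q) ℕ.* 3 ≡ suc (2 ℕ.* suc (q ℕ.* 3))
      expand = ℕSolver.solve-∀

infix 4 _≋[_]_
_≋[_]_ : Mat → ℕ → Mat → Set
M ≋[ p ] N = (m00 M ≅[ p ] m00 N) × (m01 M ≅[ p ] m01 N) × (m10 M ≅[ p ] m10 N) × (m11 M ≅[ p ] m11 N)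

module _ {p : ℕ} where

  ≈⇒≋ : ∀ {M N} → M ≈[ p ] N → M ≋[ p ] N
  ≈⇒≋ (e₀₀ , e₀₁ , e₁₀ , e₁₁) = wrap e₀₀ , wrap e₀₁ , wrap e₁₀ , wrap e₁₁

  ≋⇒≈ : ∀ {M N} → M ≋[ p ] N → M ≈[ p ] N
  ≋⇒≈ (e₀₀ , e₀₁ , e₁₀ , e₁₁) = unwrap e₀₀ , unwrap e₀₁ , unwrap e₁₀ , unwrap e₁₁

  ≋-reflexive : ∀ {M N} → M ≡ N → M ≋[ p ] N
  ≋-reflexive refl = ≅-refl , ≅-refl , ≅-refl , ≅-refl

  ≋-trans : ∀ {L M N} → L ≋[ p ] M → M ≋[ p ] N → L ≋[ p ] N
  ≋-trans (e₀₀ , e₀₁ , e₁₀ , e₁₁) (f₀₀ , f₀₁ , f₁₀ , f₁₁) =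
    ≅-trans e₀₀ f₀₀ , ≅-trans e₀₁ f₀₁ , ≅-trans e₁₀ f₁₀ , ≅-trans e₁₁ f₁₁

  ·-congˡ : ∀ L {M N} → M ≋[ p ] N → L · M ≋[ p ] L · N
  ·-congˡ (mat a b c d) (e₀₀ , e₀₁ , e₁₀ , e₁₁) =
    +-cong (*-cong (≅-refl {a = a}) e₀₀) (*-cong (≅-refl {a = b}) e₁₀) ,
    +-cong (*-cong (≅-refl {a = a}) e₀₁) (*-cong (≅-refl {a = b}) e₁₁) ,
    +-cong (*-cong (≅-refl {a = c}) e₀₀) (*-cong (≅-refl {a = d}) e₁₀) ,
    +-cong (*-cong (≅-refl {a = c}) e₀₁) (*-cong (≅-refl {a = d}) e₁₁)

nsMatrix : ℤ → ℤ → ℤ → Mat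
nsMatrix ε a b = mat a (ε * b) b a

nsMatrix-cong : ∀ {p a a′ b b′} ε → a ≅[ p ] a′ → b ≅[ p ] b′ → nsMatrix ε a b ≋[ p ] nsMatrix ε a′ b′
nsMatrix-cong ε a≅a′ b≅b′ = a≅a′ , *-cong (≅-refl {a = ε}) b≅b′ , b≅b′ , a≅a′

nsMatrix-· : ∀ ε a b c d → nsMatrix ε a b · nsMatrix ε c d ≡ nsMatrix ε (a * c + ε * b * d) (b * c + a * d)
nsMatrix-· ε a b c d = cong₂ (λ x y → mat (a * c + ε * b * d) x (b * c + a * d) y) top-right bottom-right
  where
  top-right : a * (ε * d) + ε * b * c ≡ ε * (b * c + a * d)
  top-right = solve (ε ∷ a ∷ b ∷ c ∷ d ∷ [])
  bottom-right : b * (ε * d) + a * c ≡ a * c + ε * b * d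
  bottom-right = solve (ε ∷ a ∷ b ∷ c ∷ d ∷ [])

cube-nsMatrix : ∀ ε a b →
  cube (nsMatrix ε a b) ≡ nsMatrix ε (a * a * a + + 3 * ε * a * (b * b)) (+ 3 * (a * a) * b + ε * (b * b * b))
cube-nsMatrix ε a b = begin
  nsMatrix ε a b · (nsMatrix ε a b · nsMatrix ε a b)
    ≡⟨ cong (nsMatrix ε a b ·_) (nsMatrix-· ε a b a b) ⟩
  nsMatrix ε a b · nsMatrix ε (a * a + ε * b * b) (b * a + a * b)
    ≡⟨ nsMatrix-· ε a b _ _ ⟩
  nsMatrix ε (a * (a * a + ε * b * b) + ε * b * (b * a + a * b)) (b * (a * a + ε * b * b) + a * (b * a + a * b))
    ≡⟨ cong₂ (nsMatrix ε) first-coordinate second-coordinate ⟩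
  nsMatrix ε (a * a * a + + 3 * ε * a * (b * b)) (+ 3 * (a * a) * b + ε * (b * b * b)) ∎
  where
  open ≡-Reasoning
  first-coordinate : a * (a * a + ε * b * b) + ε * b * (b * a + a * b) ≡ a * a * a + + 3 * ε * a * (b * b)
  first-coordinate = solve (ε ∷ a ∷ b ∷ [])
  second-coordinate : b * (a * a + ε * b * b) + a * (b * a + a * b) ≡ + 3 * (a * a) * b + ε * (b * b * b)
  second-coordinate = solve (ε ∷ a ∷ b ∷ [])

cube-nsMatrix-scalar : ∀ ε c → cube (nsMatrix ε c (+ 0)) ≡ nsMatrix ε (c * c * c) (+ 0)
cube-nsMatrix-scalar ε c = trans (cube-nsMatrix ε c (+ 0)) (cong₂ (nsMatrix ε) first-coordinate second-coordinate)
  where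
  first-coordinate : c * c * c + + 3 * ε * c * (+ 0 * + 0) ≡ c * c * c
  first-coordinate = solve (ε ∷ c ∷ [])
  second-coordinate : + 3 * (c * c) * + 0 + ε * (+ 0 * + 0 * + 0) ≡ + 0
  second-coordinate = solve (ε ∷ c ∷ [])

cube-nsMatrix-antidiagonal : ∀ ε d → cube (nsMatrix ε (+ 0) d) ≡ nsMatrix ε (+ 0) (ε * (d * d * d))
cube-nsMatrix-antidiagonal ε d = trans (cube-nsMatrix ε (+ 0) d) (cong₂ (nsMatrix ε) first-coordinate second-coordinate)
  where
  first-coordinate : + 0 * + 0 * + 0 + + 3 * ε * + 0 * (d * d) ≡ + 0
  first-coordinate = solve (ε ∷ d ∷ [])
  second-coordinate : + 3 * (+ 0 * + 0) * d + ε * (d * d * d) ≡ ε * (d * d * d)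
  second-coordinate = solve (ε ∷ d ∷ [])

m00-diag1-1· : ∀ N → m00 (diag1-1 · N) ≡ m00 N
m00-diag1-1· (mat a _ c _) = identity a c
  where
  identity : ∀ a c → + 1 * a + + 0 * c ≡ a
  identity = solve-∀

m10-diag1-1· : ∀ N → m10 (diag1-1 · N) ≡ - m10 N
m10-diag1-1· (mat a _ c _) = negation a c
  where
  negation : ∀ a c → + 0 * a + - (+ 1) * c ≡ - c
  negation = solve-∀

IsCnsCube : ℕ → ℤ → Mat → Set
IsCnsCube p ε M = ∃[ A ] (InCns p ε A × M ≋[ p ] cube A)

nsMatrix∈Cns : ∀ {p} ε c d → ¬ (c ≅[ p ] + 0 × d ≅[ p ] + 0) → InCns p ε (nsMatrix ε c d)
nsMatrix∈Cns ε c d cd≢0 =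
  c , d , (λ (c≡0 , d≡0) → cd≢0 (wrap c≡0 , wrap d≡0)) , ≋⇒≈ (≋-reflexive {M = nsMatrix ε c d} refl)

module _ {p : ℕ} (ε : ℤ) where

  IsCnsCube-respˡ : ∀ {M N} → M ≋[ p ] N → IsCnsCube p ε N → IsCnsCube p ε M
  IsCnsCube-respˡ M≋N (A , A∈Cns , N≋A³) = A , A∈Cns , ≋-trans M≋N N≋A³

  isCnsCube⇒InG : ∀ {M} → IsCnsCube p ε M → InG p ε M
  isCnsCube⇒InG (A , A∈Cns , M≋A³) = A , A∈Cns , inj₁ (≋⇒≈ M≋A³)

  diag1-1·isCnsCube⇒InG : ∀ {M N} → M ≋[ p ] diag1-1 · N → IsCnsCube p ε N → InG p ε M
  diag1-1·isCnsCube⇒InG {M} M≋diag1-1·N (A , A∈Cns , N≋A³) =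
    A , A∈Cns , inj₂ (≋⇒≈ {M = M} (≋-trans M≋diag1-1·N (·-congˡ diag1-1 N≋A³)))

module _ {p : ℕ} where

  InNsp⇒m10≅0⊎m00≅0 : ∀ M → InNsp p M → m10 M ≅[ p ] + 0 ⊎ m00 M ≅[ p ] + 0
  InNsp⇒m10≅0⊎m00≅0 _ (_ , inj₁ (_ , m10≡0)) = inj₁ (wrap m10≡0)
  InNsp⇒m10≅0⊎m00≅0 _ (_ , inj₂ (m00≡0 , _)) = inj₂ (wrap m00≡0)

  diag1-1·-m10≅0⊎m00≅0 : ∀ {M} N → M ≋[ p ] diag1-1 · N →
    m10 M ≅[ p ] + 0 ⊎ m00 M ≅[ p ] + 0 → m10 N ≅[ p ] + 0 ⊎ m00 N ≅[ p ] + 0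
  diag1-1·-m10≅0⊎m00≅0 {M} N (_ , _ , m10≅ , _) (inj₁ m10≅0) = inj₁ (begin
    m10 N                 ≡⟨ ℤₚ.neg-involutive (m10 N) ⟨
    - - m10 N             ≡⟨ cong -_ (m10-diag1-1· N) ⟨
    - m10 (diag1-1 · N)   ≈⟨ -‿cong (≅-sym m10≅) ⟩
    - m10 M               ≈⟨ -‿cong m10≅0 ⟩
    + 0                   ∎)
    where open SetoidReasoning (≅-setoid p)
  diag1-1·-m10≅0⊎m00≅0 {M} N (m00≅ , _) (inj₂ m00≅0) = inj₂ (begin
    m00 N                 ≡⟨ m00-diag1-1· N ⟨
    m00 (diag1-1 · N)     ≈⟨ ≅-sym m00≅ ⟩
    m00 M                 ≈⟨ m00≅0 ⟩
    + 0                   ∎)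
    where open SetoidReasoning (≅-setoid p)

module _ {p : ℕ} (ε : ℤ) where

  scalar-isCnsCube : ∀ {a b} → ∃[ c ] (c * c * c ≅[ p ] a) → ¬ (a ≅[ p ] + 0) → b ≅[ p ] + 0 →
                     IsCnsCube p ε (nsMatrix ε a b)
  scalar-isCnsCube {a} (c , c³≅a) a≢0 b≅0 =
    nsMatrix ε c (+ 0) , nsMatrix∈Cns ε c (+ 0) (a≢0 ∘ a≅0 ∘ proj₁) ,
    ≋-trans (nsMatrix-cong ε (≅-sym c³≅a) b≅0) (≋-reflexive (sym (cube-nsMatrix-scalar ε c)))
    where
    a≅0 : c ≅[ p ] + 0 → a ≅[ p ] + 0
    a≅0 c≅0 = ≅-trans (≅-sym c³≅a) (*-cong (*-cong c≅0 c≅0) c≅0)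

  antidiagonal-isCnsCube : ∀ {a b} → ∃[ d ] (ε * (d * d * d) ≅[ p ] b) → a ≅[ p ] + 0 → ¬ (b ≅[ p ] + 0) →
                           IsCnsCube p ε (nsMatrix ε a b)
  antidiagonal-isCnsCube {b = b} (d , εd³≅b) a≅0 b≢0 =
    nsMatrix ε (+ 0) d , nsMatrix∈Cns ε (+ 0) d (b≢0 ∘ b≅0 ∘ proj₂) ,
    ≋-trans (nsMatrix-cong ε a≅0 (≅-sym εd³≅b)) (≋-reflexive (sym (cube-nsMatrix-antidiagonal ε d)))
    where
    open SetoidReasoning (≅-setoid p)
    b≅0 : d ≅[ p ] + 0 → b ≅[ p ] + 0
    b≅0 d≅0 = begin
      b                ≈⟨ εd³≅b ⟨
      ε * (d * d * d)  ≈⟨ *-cong (≅-refl {a = ε}) (*-cong (*-cong d≅0 d≅0) d≅0) ⟩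
      ε * + 0          ≡⟨ ℤₚ.*-zeroʳ ε ⟩
      + 0              ∎

module _ {p : ℕ} (p-prime : Prime p) (p%3≡2 : p % 3 ≡ 2) (ε : ℤ) (ε≢0 : ¬ (ε ≅[ p ] + 0)) where

  ε-times-cube : ∀ b → ∃[ d ] (ε * (d * d * d) ≅[ p ] b)
  ε-times-cube b = multiply-by-ε (cube-root p-prime p%3≡2 (ε ^ (p ∸ 2) * b))
    where
    open SetoidReasoning (≅-setoid p)
    multiply-by-ε : ∃[ d ] (d * d * d ≅[ p ] ε ^ (p ∸ 2) * b) → ∃[ d ] (ε * (d * d * d) ≅[ p ] b)
    multiply-by-ε (d , d³≅ε⁻¹b) = d , (begin
      ε * (d * d * d)        ≈⟨ *-cong (≅-refl {a = ε}) d³≅ε⁻¹b ⟩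
      ε * (ε ^ (p ∸ 2) * b)  ≡⟨ ℤₚ.*-assoc ε (ε ^ (p ∸ 2)) b ⟨
      ε * ε ^ (p ∸ 2) * b    ≈⟨ *-cong (fermat-inverse p-prime ε≢0) (≅-refl {a = b}) ⟩
      + 1 * b                ≡⟨ ℤₚ.*-identityˡ b ⟩
      b                      ∎)

  Cns-isCnsCube : ∀ N → InCns p ε N → m10 N ≅[ p ] + 0 ⊎ m00 N ≅[ p ] + 0 → IsCnsCube p ε N
  Cns-isCnsCube N (a , b , ab≢0 , N≈ns) zero-entry =
    IsCnsCube-respˡ ε N≋ns (nsMatrix-isCnsCube zero-entry)
    where
    N≋ns : N ≋[ p ] nsMatrix ε a b
    N≋ns = ≈⇒≋ N≈ns
    nsMatrix-isCnsCube : m10 N ≅[ p ] + 0 ⊎ m00 N ≅[ p ] + 0 → IsCnsCube p ε (nsMatrix ε a b)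
    nsMatrix-isCnsCube (inj₁ m10≅0) =
      scalar-isCnsCube ε (cube-root p-prime p%3≡2 a) (λ a≅0 → ab≢0 (unwrap a≅0 , unwrap b≅0)) b≅0
      where b≅0 = ≅-trans (≅-sym (proj₁ (proj₂ (proj₂ N≋ns)))) m10≅0
    nsMatrix-isCnsCube (inj₂ m00≅0) =
      antidiagonal-isCnsCube ε (ε-times-cube b) a≅0 (λ b≅0 → ab≢0 (unwrap a≅0 , unwrap b≅0))
      where a≅0 = ≅-trans (≅-sym (proj₁ N≋ns)) m00≅0

lemma5p1 : (p : ℕ) → Prime p → p % 3 ≡ 2 → (ε : ℤ) → IsGenerator p ε →
    (M : Mat) → InH p ε M → InG p ε M
lemma5p1 p p-prime p%3≡2 ε (ε≢0 , _) M (inj₁ M∈Cns , M∈Nsp) =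
  isCnsCube⇒InG ε (Cns-isCnsCube p-prime p%3≡2 ε (ε≢0 ∘ unwrap) M M∈Cns (InNsp⇒m10≅0⊎m00≅0 M M∈Nsp))
lemma5p1 p p-prime p%3≡2 ε (ε≢0 , _) M (inj₂ (N , N∈Cns , M≈diag1-1·N) , M∈Nsp) =
  diag1-1·isCnsCube⇒InG ε M≋diag1-1·N (Cns-isCnsCube p-prime p%3≡2 ε (ε≢0 ∘ unwrap) N N∈Cns
    (diag1-1·-m10≅0⊎m00≅0 N M≋diag1-1·N (InNsp⇒m10≅0⊎m00≅0 M M∈Nsp)))
  where
  M≋diag1-1·N : M ≋[ p ] diag1-1 · N
  M≋diag1-1·N = ≈⇒≋ M≈diag1-1·N
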